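{- Fix $n \ge 1$ and $k \ge 4$, and let $\pi \in S_n(132, \tau_k, 2341)$. Let $j = \pi^{ -1}(n)$. Then: (i) If $j = 1$ and $n > 1$, then $\pi = n, \sigma$ for some $\sigma \in S_{n-1}(132, \tau_{k-1}, 2341)$. (ii) If $j = 2$ and $n > 2$, then $\pi = n-1, n, \sigma$ for some $\sigma \in S_{n-2}(132, \tau_{k-1}, 2341)$. (iii) If $3 \le j \le k-3$ and $j < n$, then $\pi = n-1, n-2, \ldots, n-j+1, n, \sigma$ for some $\sigma \in S_{n-j}(132, \tau_{k-j+1}, 2341)$. (iv) If $k-2 \le j \le n-1$, then $\pi = n-1, n-2, \ldots, n-j+1, n, \sigma$ for some $\sigma \in S_{n-j}(132, 213, 2341)$. (v) If $j = n$, then $\pi = \sigma, n$ for some $\sigma \in S_{n-1}(132, \tau_k, 2341)$.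
   Context: Permutations of $[n]$ are written in one-line notation, and $S_n$ denotes the set of them; $\pi^{ -1}(n)$ is the position of the entry $n$. A permutation $\pi\in S_n$ contains $\sigma\in S_m$ if there are indices $i_1<\dots<i_m$ such that for all $a,b$, $\pi(i_a)<\pi(i_b)$ iff $\sigma(a)<\sigma(b)$; otherwise $\pi$ avoids $\sigma$. For a set $R$ of permutations, $S_n(R)$ is the set of $\pi\in S_n$ avoiding every element of $R$; $S_0(R)$ consists of the empty permutation only. For $m \ge 4$, $\tau_m = m\,(m-1)\ldots 4\,2\,1\,3 \in S_m$ lists $m, m-1, \dots, 4$ in decreasing order followed by $2,1,3$ (e.g. $\tau_4 = 4213$), and $\tau_3 = 213$. -}

module Defs where

open import Data.Nat using (ℕ; zero; suc; _∸_; _<_)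
open import Data.List using (List; []; _∷_; _++_; map; upTo; length; lookup)
open import Data.List.Relation.Binary.Permutation.Propositional using (_↭_)
open import Data.List.Relation.Binary.Sublist.Propositional using (_⊆_)
open import Data.List.Relation.Unary.All using (All)
open import Data.Fin using (cast)
open import Data.Product using (Σ; ∃-syntax; _×_)
open import Function.Bundles using (_⇔_)
open import Relation.Binary.PropositionalEquality using (_≡_)
open import Relation.Nullary using (¬_)

IsPerm : ℕ → List ℕ → Set
IsPerm n π = π ↭ map suc (upTo n)

OrderIso : List ℕ → List ℕ → Set
OrderIso s σ = Σ (length s ≡ length σ) λ e →
  ∀ a b → (lookup s a < lookup s b) ⇔ (lookup σ (cast e a) < lookup σ (cast e b))

Contains : List ℕ → List ℕ → Set
Contains π σ = ∃[ s ] (s ⊆ π × OrderIso s σ)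

Avoids : List ℕ → List ℕ → Set
Avoids π σ = ¬ Contains π σ

InS : ℕ → List (List ℕ) → List ℕ → Set
InS n R π = IsPerm n π × All (Avoids π) R

p132 p213 p2341 : List ℕ
p132 = 1 ∷ 3 ∷ 2 ∷ []
p213 = 2 ∷ 1 ∷ 3 ∷ []
p2341 = 2 ∷ 3 ∷ 4 ∷ 1 ∷ []

-- τ_m = m (m-1) … 4 2 1 3 (for m ≥ 4), τ_3 = 213.
tau : ℕ → List ℕ
tau m = map (λ i → m ∸ i) (upTo (m ∸ 3)) ++ (2 ∷ 1 ∷ 3 ∷ [])

-- n-1, n-2, …, n-j+1  (j-1 entries)
descPrefix : ℕ → ℕ → List ℕ
descPrefix n j = map (λ i → n ∸ suc i) (upTo (j ∸ 1))

-- Write π = α n β. Avoiding 132 puts every entry of α above every entry of β. When β is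
-- nonempty, an increase a < a′ inside α would give an occurrence a a′ n c of 2341 with c in β,
-- so α decreases; as α β is a permutation of [n-1], α must be n-1, n-2, …, n-j+1 and β a
-- permutation of [n-j]. An entry larger than everything after it can be put in front of an
-- occurrence of τ_m to give one of τ_(m+1); using n, or entries of α, this way turns an
-- occurrence of the smaller τ in β into one of τ_k in π.

module Submission where

open import Defs
open import Data.Nat using (ℕ; zero; suc; _∸_; _+_; _≤_; _<_; z≤n; s≤s; _<?_)
open import Data.Nat.Properties
  using (<-cmp; <-irrefl; <-asym; <-trans; ≤-trans; ≤-refl; ≤-pred; <⇒≱; n<1+n; n≤1+n;
         m≤m+n; m≤n+m; +-identityʳ; +-comm; +-assoc; m+1+n≢m; m+[n∸m]≡n; m∸n+n≡m; m∸n≤m;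
         ∸-+-assoc; ∸-monoˡ-≤; m≤o∸n⇒m+n≤o; m+n≤o⇒m≤o∸n; suc-injective)
open import Data.List using (List; []; _∷_; _++_; length; map; upTo; lookup; [_])
open import Data.List.Properties
  using (map-upTo; map-applyUpTo; upTo-∷ʳ; map-++; length-++; length-upTo; length-map)
import Data.List.Properties as List
open import Data.List.Relation.Binary.Permutation.Propositional using (_↭_; ↭-sym; ↭-trans; ↭⇒↭ₛ)
open import Data.List.Relation.Binary.Permutation.Propositional.Properties
  using (All-resp-↭; ∈-resp-↭; drop-mid; shift; ++-identityʳ; ↭-length; ¬x∷xs↭[])
import Data.List.Relation.Binary.Permutation.Setoid.Properties as ↭ₛ
open import Data.List.Relation.Binary.Sublist.Propositional
  using (_⊆_; _∷_; _∷ʳ_; ⊆-refl; ⊆-trans; from∈; to∈)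
open import Data.List.Relation.Binary.Sublist.Propositional.Properties
  using (++⁺; ++⁺ˡ; ++⁺ʳ; ∷ˡ⁻; All-resp-⊆)
open import Data.List.Relation.Unary.All using (All; []; _∷_)
import Data.List.Relation.Unary.All as All
import Data.List.Relation.Unary.All.Properties as All
open import Data.List.Relation.Unary.AllPairs using (AllPairs; _∷_)
open import Data.List.Relation.Unary.Any using (here; there)
open import Data.List.Relation.Unary.Unique.Propositional using (Unique)
import Data.List.Relation.Unary.Unique.Propositional.Properties as Unique
open import Data.List.Membership.Propositional using (_∈_)
open import Data.List.Membership.Propositional.Properties
  using (∈-map⁺; ∈-upTo⁺; ∈-upTo⁻; ∈-++⁺ˡ; ∈-++⁺ʳ; ∈-lookup)
open import Data.Fin using (zero; suc; cast)
open import Data.Product using (∃-syntax; _×_; _,_; proj₁; proj₂)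
open import Data.Empty using (⊥-elim)
open import Data.Unit using (⊤; tt)
open import Function using (_∘_)
open import Function.Bundles using (_⇔_; mk⇔)
open import Relation.Binary.Definitions using (tri<; tri≈; tri>)
open import Relation.Binary.PropositionalEquality
  using (_≡_; refl; sym; trans; cong; subst; setoid)
open import Relation.Nullary using (¬_)
open import Relation.Nullary.Decidable using (True; False; toWitness; toWitnessFalse)

range : ℕ → List ℕ
range n = map suc (upTo n)

map-upTo-suc : ∀ {A : Set} (f : ℕ → A) n → map f (upTo (suc n)) ≡ f 0 ∷ map (f ∘ suc) (upTo n)
map-upTo-suc f n = cong (f 0 ∷_) (trans (map-applyUpTo suc f n) (sym (map-upTo (f ∘ suc) n)))

range-suc : ∀ m → range (suc m) ≡ range m ++ [ suc m ]
range-suc m = trans (cong (map suc) (sym (upTo-∷ʳ m))) (map-++ suc (upTo m) [ m ])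

length-range : ∀ m → length (range m) ≡ m
length-range m = trans (length-map suc (upTo m)) (length-upTo m)

range-bounded : ∀ m → All (_< suc m) (range m)
range-bounded m = All.map⁺ (All.tabulate (s≤s ∘ ∈-upTo⁻))

range-unique : ∀ m → Unique (range m)
range-unique m = Unique.map⁺ suc-injective (Unique.upTo⁺ m)

max∈range : ∀ m → suc m ∈ range (suc m)
max∈range m = ∈-map⁺ suc (∈-upTo⁺ (n<1+n m))

max-of-range : ∀ {m a xs} → (a ∷ xs) ↭ range (suc m) → All (_< a) xs → a ≡ suc m
max-of-range {m} {a} p a>xs with ∈-resp-↭ (↭-sym p) (max∈range m)
... | here m≡a    = sym m≡a
... | there m∈xs = ⊥-elim (<⇒≱ (All.lookup a>xs m∈xs) a≤m)
  where
  a≤m : a ≤ suc m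
  a≤m = ≤-pred (All.lookup (range-bounded (suc m)) (∈-resp-↭ p (here refl)))

descPrefix-suc : ∀ m l → descPrefix (suc (suc m)) (suc (suc l)) ≡ suc m ∷ descPrefix (suc m) (suc l)
descPrefix-suc m l = map-upTo-suc (λ i → suc (suc m) ∸ suc i) l

Unique-resp-↭ : ∀ {A : Set} {xs ys : List A} → xs ↭ ys → Unique xs → Unique ys
Unique-resp-↭ {A} p = ↭ₛ.Unique-resp-↭ (setoid A) (↭⇒↭ₛ p)

AllPairs-⊆-pair : ∀ {A : Set} {R : A → A → Set} {x y zs} → AllPairs R zs → (x ∷ y ∷ []) ⊆ zs → R x y
AllPairs-⊆-pair (_ ∷ rs)   (_ ∷ʳ p)   = AllPairs-⊆-pair rs p
AllPairs-⊆-pair (rx ∷ _)   (refl ∷ p) = All.lookup rx (to∈ p)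

Contains-⊆ : ∀ {σ π ρ} → σ ⊆ π → Contains σ ρ → Contains π ρ
Contains-⊆ σ⊆π (s , s⊆σ , iso) = s , ⊆-trans s⊆σ σ⊆π , iso

Avoids-⊆ : ∀ {σ π ρ} → σ ⊆ π → Avoids π ρ → Avoids σ ρ
Avoids-⊆ {ρ = ρ} σ⊆π av = av ∘ Contains-⊆ {ρ = ρ} σ⊆π

both : ∀ {P Q : Set} → P → Q → P ⇔ Q
both p q = mk⇔ (λ _ → q) (λ _ → p)

neither : ∀ {P Q : Set} → ¬ P → ¬ Q → P ⇔ Q
neither ¬p ¬q = mk⇔ (⊥-elim ∘ ¬p) (⊥-elim ∘ ¬q)

<-decide : ∀ {a b} {t : True (a <? b)} → a < b
<-decide {t = t} = toWitness t

≮-decide : ∀ {a b} {t : False (a <? b)} → ¬ a < b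
≮-decide {t = t} = toWitnessFalse t

≮-refl : ∀ {a} → ¬ a < a
≮-refl = <-irrefl refl

OrderIso-132 : ∀ {a b c} → a < b → b < c → OrderIso (a ∷ c ∷ b ∷ []) p132
OrderIso-132 a<b b<c = refl , λ
  { zero zero                   → neither ≮-refl ≮-decide
  ; zero (suc zero)             → both a<c <-decide
  ; zero (suc (suc zero))       → both a<b <-decide
  ; (suc zero) zero             → neither (<-asym a<c) ≮-decide
  ; (suc zero) (suc zero)       → neither ≮-refl ≮-decide
  ; (suc zero) (suc (suc zero)) → neither (<-asym b<c) ≮-decide
  ; (suc (suc zero)) zero       → neither (<-asym a<b) ≮-decide
  ; (suc (suc zero)) (suc zero) → both b<c <-decide
  ; (suc (suc zero)) (suc (suc zero)) → neither ≮-refl ≮-decide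
  }
  where
  a<c = <-trans a<b b<c

OrderIso-2341 : ∀ {a b c d} → d < a → a < b → b < c → OrderIso (a ∷ b ∷ c ∷ d ∷ []) p2341
OrderIso-2341 d<a a<b b<c = refl , λ
  { zero zero                                     → neither ≮-refl ≮-decide
  ; zero (suc zero)                               → both a<b <-decide
  ; zero (suc (suc zero))                         → both a<c <-decide
  ; zero (suc (suc (suc zero)))                   → neither (<-asym d<a) ≮-decide
  ; (suc zero) zero                               → neither (<-asym a<b) ≮-decide
  ; (suc zero) (suc zero)                         → neither ≮-refl ≮-decide
  ; (suc zero) (suc (suc zero))                   → both b<c <-decide
  ; (suc zero) (suc (suc (suc zero)))             → neither (<-asym d<b) ≮-decide
  ; (suc (suc zero)) zero                         → neither (<-asym a<c) ≮-decide
  ; (suc (suc zero)) (suc zero)                   → neither (<-asym b<c) ≮-decide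
  ; (suc (suc zero)) (suc (suc zero))             → neither ≮-refl ≮-decide
  ; (suc (suc zero)) (suc (suc (suc zero)))       → neither (<-asym d<c) ≮-decide
  ; (suc (suc (suc zero))) zero                   → both d<a <-decide
  ; (suc (suc (suc zero))) (suc zero)             → both d<b <-decide
  ; (suc (suc (suc zero))) (suc (suc zero))       → both d<c <-decide
  ; (suc (suc (suc zero))) (suc (suc (suc zero))) → neither ≮-refl ≮-decide
  }
  where
  a<c = <-trans a<b b<c
  d<b = <-trans d<a a<b
  d<c = <-trans d<b b<c

OrderIso-∷-max : ∀ {x y s t} → OrderIso s t → All (_< x) s → All (_< y) t → OrderIso (x ∷ s) (y ∷ t)
OrderIso-∷-max {x} {y} {s} {t} (s≈t , iso) x>s y>t = cong suc s≈t , iso′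
  where
  below : ∀ {z zs} → All (_< z) zs → ∀ i → lookup zs i < z
  below z>zs i = All.lookup z>zs (∈-lookup i)
  iso′ : ∀ a b → (lookup (x ∷ s) a < lookup (x ∷ s) b)
                 ⇔ (lookup (y ∷ t) (cast (cong suc s≈t) a) < lookup (y ∷ t) (cast (cong suc s≈t) b))
  iso′ zero    zero    = neither ≮-refl ≮-refl
  iso′ zero    (suc b) = neither (<-asym (below x>s b)) (<-asym (below y>t (cast s≈t b)))
  iso′ (suc a) zero    = both (below x>s a) (below y>t (cast s≈t a))
  iso′ (suc a) (suc b) = iso a b

tau-suc : ∀ {M} → 3 ≤ M → tau (suc M) ≡ suc M ∷ tau M
tau-suc {suc (suc (suc t))} (s≤s (s≤s (s≤s _))) =
  cong (_++ 2 ∷ 1 ∷ 3 ∷ []) (map-upTo-suc (suc (suc (suc (suc t))) ∸_) t)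

tau-bounded : ∀ {M} → 3 ≤ M → All (_< suc M) (tau M)
tau-bounded {3}                       (s≤s (s≤s (s≤s _))) = <-decide ∷ <-decide ∷ <-decide ∷ []
tau-bounded {suc (suc (suc (suc t)))} (s≤s (s≤s (s≤s _))) =
  subst (All (_< suc (suc (suc (suc (suc t)))))) (sym (tau-suc (m≤m+n 3 t)))
    (n<1+n _ ∷ All.map (λ p → <-trans p (n<1+n _)) (tau-bounded {suc (suc (suc t))} (m≤m+n 3 t)))

DescendingAbove : List ℕ → List ℕ → Set
DescendingAbove []      σ = ⊤
DescendingAbove (x ∷ d) σ = All (_< x) (d ++ σ) × DescendingAbove d σ

tau-lift : ∀ {d σ m} r → 3 ≤ m → r ≤ length d → DescendingAbove d σ →
           Contains σ (tau m) → Contains (d ++ σ) (tau (r + m))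
tau-lift {d} zero _ _ _ (s , s⊆σ , iso) = s , ++⁺ˡ d s⊆σ , iso
tau-lift {x ∷ d} {m = m} (suc r) 3≤m (s≤s r≤d) (x>rest , desc) c
  with s , s⊆ , iso ← tau-lift r 3≤m r≤d desc c =
  x ∷ s , refl ∷ s⊆ ,
  subst (OrderIso (x ∷ s)) (sym (tau-suc 3≤r+m))
    (OrderIso-∷-max iso (All-resp-⊆ s⊆ x>rest) (tau-bounded 3≤r+m))
  where
  3≤r+m : 3 ≤ r + m
  3≤r+m = ≤-trans 3≤m (m≤n+m m r)

descendingAbove : ∀ {α β} → (∀ {a a′} → (a ∷ a′ ∷ []) ⊆ α → a′ < a) →
                  (∀ {a b} → a ∈ α → b ∈ β → b < a) → DescendingAbove α β
descendingAbove {[]}    _   _     = tt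
descendingAbove {a ∷ α} dec above =
  All.++⁺ (All.tabulate (λ a′∈α → dec (refl ∷ from∈ a′∈α))) (All.tabulate (above (here refl))) ,
  descendingAbove (dec ∘ (a ∷ʳ_)) (above ∘ there)

module _ {m : ℕ} {α β : List ℕ} (perm : IsPerm (suc m) (α ++ suc m ∷ β)) where

  delete-max : (α ++ β) ↭ range m
  delete-max = ↭-trans (drop-mid α (range m) (subst ((α ++ suc m ∷ β) ↭_) (range-suc m) perm))
                       (++-identityʳ (range m))

  length-others : length α + length β ≡ m
  length-others = trans (sym (length-++ α)) (trans (↭-length delete-max) (length-range m))

  others<max : All (_< suc m) (α ++ β)
  others<max = All-resp-↭ (↭-sym delete-max) (range-bounded m)

  others-unique : Unique (α ++ β)
  others-unique = Unique-resp-↭ (↭-sym delete-max) (range-unique m)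

  prefix-above-suffix : Avoids (α ++ suc m ∷ β) p132 → ∀ {a b} → a ∈ α → b ∈ β → b < a
  prefix-above-suffix av {a} {b} a∈α b∈β with <-cmp a b
  ... | tri< a<b _ _ = ⊥-elim (av (_ , ++⁺ (from∈ a∈α) (refl ∷ from∈ b∈β) , OrderIso-132 a<b b<max))
    where
    b<max = All.lookup others<max (∈-++⁺ʳ α b∈β)
  ... | tri≈ _ a≡b _ = ⊥-elim (AllPairs-⊆-pair others-unique (++⁺ (from∈ a∈α) (from∈ b∈β)) a≡b)
  ... | tri> _ _ b<a = b<a

  prefix-decreasing : Avoids (α ++ suc m ∷ β) p132 → Avoids (α ++ suc m ∷ β) p2341 →
                      ∀ {c} → c ∈ β → ∀ {a a′} → (a ∷ a′ ∷ []) ⊆ α → a′ < a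
  prefix-decreasing av132 av2341 c∈β {a} {a′} aa′⊆α with <-cmp a a′
  ... | tri< a<a′ _ _ =
    ⊥-elim (av2341 (_ , ++⁺ aa′⊆α (refl ∷ from∈ c∈β) , OrderIso-2341 c<a a<a′ a′<max))
    where
    c<a = prefix-above-suffix av132 (to∈ aa′⊆α) c∈β
    a′<max = All.lookup others<max (∈-++⁺ˡ (to∈ (∷ˡ⁻ aa′⊆α)))
  ... | tri≈ _ a≡a′ _ = ⊥-elim (AllPairs-⊆-pair others-unique (++⁺ʳ β aa′⊆α) a≡a′)
  ... | tri> _ _ a′<a = a′<a

descending-prefix : ∀ {m α β} → IsPerm (suc m) (α ++ suc m ∷ β) → DescendingAbove α β →
                    α ≡ descPrefix (suc m) (suc (length α)) × IsPerm (m ∸ length α) β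
descending-prefix {m}     {[]}    {β} perm _ = refl , delete-max {α = []} {β} perm
descending-prefix {zero}  {a ∷ α} {β} perm _ = ⊥-elim (¬x∷xs↭[] (delete-max {α = a ∷ α} {β} perm))
-- The head of α is the largest value in α β, so it takes over the role of the maximum for the tail.
descending-prefix {suc m} {a ∷ α} {β} perm (a>rest , desc)
  with refl ← max-of-range (delete-max {α = a ∷ α} {β} perm) a>rest
  with α≡ , β-perm ← descending-prefix (↭-trans (shift (suc m) α β)
                                                  (delete-max {α = suc m ∷ α} {β} perm)) desc
  = trans (cong (suc m ∷_) α≡) (sym (descPrefix-suc m (length α))) , β-perm

InS-sublist : ∀ {σ π n m ρ ρ′} → σ ⊆ π → IsPerm n σ → (Contains σ ρ′ → Contains π ρ) →
              InS m (p132 ∷ ρ ∷ p2341 ∷ []) π → InS n (p132 ∷ ρ′ ∷ p2341 ∷ []) σ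
InS-sublist σ⊆π perm transfer (_ , av132 ∷ avρ ∷ av2341 ∷ []) =
  perm , Avoids-⊆ σ⊆π av132 ∷ avρ ∘ transfer ∷ Avoids-⊆ σ⊆π av2341 ∷ []

max-first : ∀ {m k α β} → 4 ≤ k → InS (suc m) (p132 ∷ tau k ∷ p2341 ∷ []) (α ++ suc m ∷ β) →
            suc (length α) ≡ 1 →
            ∃[ σ ] (α ++ suc m ∷ β ≡ suc m ∷ σ × InS m (p132 ∷ tau (k ∸ 1) ∷ p2341 ∷ []) σ)
max-first {m} {k} {[]} {β} 4≤k h@(perm , _) refl =
  β , refl , InS-sublist (suc m ∷ʳ ⊆-refl) (delete-max {α = []} perm) lift h
  where
  lift : Contains β (tau (k ∸ 1)) → Contains (suc m ∷ β) (tau k)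
  lift = subst (Contains (suc m ∷ β) ∘ tau) (m+[n∸m]≡n (≤-trans (s≤s z≤n) 4≤k))
       ∘ tau-lift 1 (∸-monoˡ-≤ 1 4≤k) ≤-refl (others<max {α = []} perm , tt)

max-inner : ∀ {m k α β} → InS (suc m) (p132 ∷ tau k ∷ p2341 ∷ []) (α ++ suc m ∷ β) →
            length α < m → ∀ r t → 3 ≤ t → r ≤ length α → t + r ≡ k →
            ∃[ σ ] (α ++ suc m ∷ β ≡ descPrefix (suc m) (suc (length α)) ++ suc m ∷ σ
                    × InS (m ∸ length α) (p132 ∷ tau t ∷ p2341 ∷ []) σ)
max-inner {α = α} {[]} (perm , _) α<m _ _ _ _ _ =
  ⊥-elim (<-irrefl (trans (sym (+-identityʳ (length α))) (length-others perm)) α<m)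
max-inner {m} {k} {α} {c ∷ β} h@(perm , av132 ∷ _ ∷ av2341 ∷ []) _ r t 3≤t r≤α t+r≡k
  = c ∷ β , cong (_++ suc m ∷ c ∷ β) (proj₁ shape) ,
    InS-sublist (++⁺ˡ α (suc m ∷ʳ ⊆-refl)) (proj₂ shape) lift h
  where
  desc : DescendingAbove α (c ∷ β)
  desc = descendingAbove (prefix-decreasing perm av132 av2341 (here refl))
                         (prefix-above-suffix perm av132)
  shape : α ≡ descPrefix (suc m) (suc (length α)) × IsPerm (m ∸ length α) (c ∷ β)
  shape = descending-prefix perm desc
  lift : Contains (c ∷ β) (tau t) → Contains (α ++ suc m ∷ c ∷ β) (tau k)
  lift = subst (Contains (α ++ suc m ∷ c ∷ β) ∘ tau) (trans (+-comm r t) t+r≡k)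
       ∘ Contains-⊆ {ρ = tau (r + t)} (++⁺ ⊆-refl (suc m ∷ʳ ⊆-refl))
       ∘ tau-lift r 3≤t r≤α desc

max-second : ∀ {m k α β} → 4 ≤ k → InS (suc m) (p132 ∷ tau k ∷ p2341 ∷ []) (α ++ suc m ∷ β) →
             suc (length α) ≡ 2 → 2 < suc m →
             ∃[ σ ] (α ++ suc m ∷ β ≡ m ∷ suc m ∷ σ
                     × InS (m ∸ 1) (p132 ∷ tau (k ∸ 1) ∷ p2341 ∷ []) σ)
max-second {k = k} {α = a ∷ []} {β} 4≤k h refl 2<n =
  max-inner {α = a ∷ []} {β} h (≤-pred 2<n) 1 (k ∸ 1)
            (∸-monoˡ-≤ 1 4≤k) ≤-refl (m∸n+n≡m (≤-trans (s≤s z≤n) 4≤k))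

max-last : ∀ {m ρ α β} → InS (suc m) (p132 ∷ ρ ∷ p2341 ∷ []) (α ++ suc m ∷ β) →
           suc (length α) ≡ suc m →
           ∃[ σ ] (α ++ suc m ∷ β ≡ σ ++ suc m ∷ [] × InS m (p132 ∷ ρ ∷ p2341 ∷ []) σ)
max-last {α = α} {_ ∷ _} (perm , _) j≡n =
  ⊥-elim (m+1+n≢m (length α) (trans (length-others perm) (sym (suc-injective j≡n))))
max-last {m} {ρ} {α} {[]} h@(perm , _) _ =
  α , refl , InS-sublist prefix α-perm (Contains-⊆ {ρ = ρ} prefix) h
  where
  prefix : α ⊆ α ++ suc m ∷ []
  prefix = ++⁺ʳ (suc m ∷ []) ⊆-refl
  α-perm : IsPerm m α
  α-perm = subst (_↭ range m) (List.++-identityʳ α) (delete-max perm)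

lemma4p1 : (n k : ℕ) → 1 ≤ n → 4 ≤ k → (π : List ℕ) →
    InS n (p132 ∷ tau k ∷ p2341 ∷ []) π →
    (α β : List ℕ) → π ≡ α ++ n ∷ β →
    let j = suc (length α) in
    (j ≡ 1 → 1 < n →
      ∃[ σ ] (π ≡ n ∷ σ × InS (n ∸ 1) (p132 ∷ tau (k ∸ 1) ∷ p2341 ∷ []) σ))
    × (j ≡ 2 → 2 < n →
      ∃[ σ ] (π ≡ (n ∸ 1) ∷ n ∷ σ × InS (n ∸ 2) (p132 ∷ tau (k ∸ 1) ∷ p2341 ∷ []) σ))
    × (3 ≤ j → j ≤ k ∸ 3 → j < n →
      ∃[ σ ] (π ≡ descPrefix n j ++ n ∷ σ
               × InS (n ∸ j) (p132 ∷ tau (k ∸ j + 1) ∷ p2341 ∷ []) σ))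
    × (k ∸ 2 ≤ j → j ≤ n ∸ 1 →
      ∃[ σ ] (π ≡ descPrefix n j ++ n ∷ σ × InS (n ∸ j) (p132 ∷ p213 ∷ p2341 ∷ []) σ))
    × (j ≡ n →
      ∃[ σ ] (π ≡ σ ++ n ∷ [] × InS (n ∸ 1) (p132 ∷ tau k ∷ p2341 ∷ []) σ))
lemma4p1 (suc m) k _ 4≤k .(α ++ suc m ∷ β) h α β refl =
    (λ j≡1 _ → max-first 4≤k h j≡1)
  , max-second 4≤k h
  , (λ _ j≤k∸3 j<n → max-inner h (≤-pred j<n) (length α) (k ∸ j + 1)
                       (≤-trans (3≤k∸j j≤k∸3) (m≤m+n _ 1)) ≤-refl (inner-length j≤k∸3))
  -- tau 3 computes to p213, so here β is lifted from τ_3 by k - 3 entries of α.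
  , (λ k∸2≤j j≤m → max-inner h j≤m (k ∸ 3) 3 ≤-refl (k∸3≤l k∸2≤j) (m+[n∸m]≡n 3≤k))
  , max-last h
  where
  j : ℕ
  j = suc (length α)
  3≤k : 3 ≤ k
  3≤k = ≤-trans (n≤1+n 3) 4≤k
  3≤k∸j : j ≤ k ∸ 3 → 3 ≤ k ∸ j
  3≤k∸j j≤k∸3 = m+n≤o⇒m≤o∸n 3 (subst (_≤ k) (+-comm j 3) (m≤o∸n⇒m+n≤o j 3≤k j≤k∸3))
  inner-length : j ≤ k ∸ 3 → k ∸ j + 1 + length α ≡ k
  inner-length j≤k∸3 = trans (+-assoc (k ∸ j) 1 (length α)) (m∸n+n≡m (≤-trans j≤k∸3 (m∸n≤m k 3)))
  k∸3≤l : k ∸ 2 ≤ j → k ∸ 3 ≤ length α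
  k∸3≤l k∸2≤j = subst (_≤ length α) (∸-+-assoc k 2 1) (∸-monoˡ-≤ 1 k∸2≤j)
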